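{- Let $\Delta$ be one of the negative discriminants of class number one, $\Delta\in\{ -3,-4,-7,-8,-11,-19,-43,-67,-163\}$, and let $Q(x,y)=x^2+hy^2$ with $h=-\Delta/4$ if $\Delta\in\{ -4,-8\}$, and $Q(x,y)=x^2+xy+hy^2$ with $h=(1-\Delta)/4$ otherwise. Let $m_0,z_0\in\mathbb{Z}$ with $|m_0|>1$, $1<|z_0|<|m_0|$ and $m_0\mid Q(z_0,1)$. Consider the procedure: starting with $s=0$, while $|m_s|\ne1$, increase $s$ by $1$, set $m_s=Q(z_{s-1},1)/m_{s-1}$, and choose integers $k_s,z_s$ with $z_{s-1}=k_sm_s+z_s$ and $|z_s|<|m_s|$, choosing $k_s\neq0$ whenever a non-zero quotient with this property exists. Then every $m_s$ is an integer, the procedure terminates, and at termination $m_s=\pm1$. Moreover, setting $(q_1,\dots,q_s)=(k_s,k_{s-1},\dots,k_1)$ and $x=[m_sq_1,m_s^{ -1}q_2,\dots,m_s^{(-1)^{s-2}}q_{s-1},m_s^{(-1)^{s-1}}q_s]$, $y=[m_s^{ -1}q_2,\dots,m_s^{(-1)^{s-2}}q_{s-1},m_s^{(-1)^{s-1}}q_s]$, one has $\gcd(x,y)=1$ and $Q(x,y)=m_0/u$ with $u=\pm1$ (namely $Q(x,y)=m_0m_s^{(-1)^{s+1}}=m_0m_s$).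
   Context: Continuants are defined by $[\,]=1$, $[q_1]=q_1$, $[q_1,q_2]=q_1q_2+1$ and $[q_1,\dots,q_n]=[q_1,\dots,q_{n-1}]q_n+[q_1,\dots,q_{n-2}]$ for $n\ge3$. The class number of a discriminant $\Delta$ is the number of equivalence classes (under $\mathrm{SL}_2(\mathbb{Z})$ change of variables) of integral binary quadratic forms of discriminant $\Delta$. -}

module Defs where

open import Data.Nat as ℕ using (ℕ; zero; suc)
open import Data.Integer hiding (suc)
open import Data.Integer.Base using (_/_)
open import Data.List using (List; _∷_; [])
open import Data.List.Membership.Propositional using (_∈_)
open import Data.Empty using (⊥)
open import Relation.Binary.PropositionalEquality using (_≡_; _≢_)
open import Data.Product using (_×_)
open import Data.Sum using (_⊎_)

classNumberOneDiscs : List ℤ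
classNumberOneDiscs =
  -[1+ 2 ] ∷ -[1+ 3 ] ∷ -[1+ 6 ] ∷ -[1+ 7 ] ∷ -[1+ 10 ] ∷ -[1+ 18 ] ∷ -[1+ 42 ] ∷ -[1+ 66 ] ∷ -[1+ 162 ] ∷ []

isEvenCase : ℤ → Set
isEvenCase Δ = (Δ ≡ -[1+ 3 ]) ⊎ (Δ ≡ -[1+ 7 ])

Qform : ℤ → ℤ → ℤ → ℤ
Qform (-[1+ 3 ]) x y = x * x + ((- -[1+ 3 ]) / + 4) * (y * y)
Qform (-[1+ 7 ]) x y = x * x + ((- -[1+ 7 ]) / + 4) * (y * y)
Qform Δ x y = x * x + x * y + ((+ 1 - Δ) / + 4) * (y * y)

-- Total integer division (quotient a / b, with the junk value 0 for b = 0).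
-- Used to express m_s = Q(z_{s-1},1) / m_{s-1}; the theorem asserts divisibility.
divℤ : ℤ → ℤ → ℤ
divℤ a (+ zero) = + 0
divℤ a (+[1+ n ]) = a / +[1+ n ]
divℤ a (-[1+ n ]) = a / -[1+ n ]

-- Continuant [q 1, ..., q n] of the entries q 1, ..., q n (index 0 unused):
-- [ ] = 1, [q1] = q1, [q1..qn] = [q1..q(n-1)] qn + [q1..q(n-2)].
cont : ℕ → (ℕ → ℤ) → ℤ
cont zero q = + 1
cont (suc zero) q = q 1
cont (suc (suc n)) q = cont (suc n) q * q (suc (suc n)) + cont n q

Running : (ℕ → ℤ) → ℕ → Set
Running m s = ∀ j → j ℕ.≤ s → ∣ m j ∣ ≢ 1

StepOK : ℤ → (ℕ → ℤ) → (ℕ → ℤ) → (ℕ → ℤ) → ℕ → Set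
StepOK Δ m z k s =
  (m (suc s) ≡ divℤ (Qform Δ (z s) (+ 1)) (m s)) ×
  (z s ≡ k (suc s) * m (suc s) + z (suc s)) ×
  (∣ z (suc s) ∣ ℕ.< ∣ m (suc s) ∣) ×
  ((k (suc s) ≢ + 0) ⊎
   (∀ k′ → k′ ≢ + 0 → ∣ z s - k′ * m (suc s) ∣ ℕ.< ∣ m (suc s) ∣ → ⊥))

-- Along the procedure the continuants u_s = [k₁, …, k_s] and
-- v_s = [k₁, …, k_{s-1}] represent Q(m_s u_s + z_s v_s, v_s) = m₀ m_s, because m_{s+1} m_s = Q(z_s, 1)
-- makes Q equivalent to m_s u² + (2 z_s + b) u v + m_{s+1} v². For the nine forms of class number one,
-- m ∣ Q(z, 1) with |z| < |m| forces Q(z, 1) < m², except at one residue z = c where Q(z, 1) = m²; from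
-- there the rule k ≠ 0 moves z away from c. Hence 2 |m_s| + [z_s = c] decreases, and the procedure stops
-- with |m_T| = 1 and z_T = 0. Reversing the entries and scaling them by the unit m_T turns the
-- representation into the stated one, and consecutive continuants are coprime.

{-# OPTIONS --safe #-}
module Submission where

open import Defs
open import Data.Nat as ℕ using (ℕ; suc; _∸_)
open import Data.Integer hiding (suc)
open import Data.Integer.GCD using (gcd)
open import Data.Integer.Divisibility using (_∣_)
open import Data.List.Membership.Propositional using (_∈_)
open import Data.Product using (_×_; ∃-syntax)
open import Relation.Binary.PropositionalEquality using (_≡_; _≢_)

open import Data.Nat using (zero; z≤n; s≤s) renaming (>-nonZero to >-nonZeroℕ)
open import Data.Nat.Induction using (<-wellFounded)
open import Induction.WellFounded using (Acc; acc)
open import Data.Bool using (true; false; if_then_else_)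
import Data.Nat.Properties as ℕₚ
import Data.Nat.Divisibility as ℕ∣
open import Data.Nat.GCD using () renaming (gcd to gcdℕ)
open import Data.Integer.Properties
open import Data.Integer.DivMod using (a≡a%n+[a/n]*n; n%d<d)
open import Data.Integer.GCD using (gcd[i,j]∣i; gcd[i,j]∣j)
open import Data.Integer.Divisibility.Signed as Signed using (divides; ∣ᵤ⇒∣; ∣⇒∣ᵤ)
  renaming (_∣_ to _∣ₛ_)
open import Data.Integer.Tactic.RingSolver using (solve-∀)
open import Data.List.Relation.Unary.Any using (here; there)
open import Data.Product using (_,_; proj₁; proj₂)
open import Data.Sum using (_⊎_; inj₁; inj₂; [_,_]′)
open import Data.Empty using (⊥-elim)
open import Function using (_∘_)
open import Relation.Nullary using (Dec; yes; no; does)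
open import Relation.Nullary.Decidable using (_→-dec_; _⊎-dec_; _×-dec_; toWitness; dec-true; dec-false)
open import Relation.Binary.PropositionalEquality
  using (refl; sym; trans; cong; cong₂; subst; subst₂; module ≡-Reasoning)

-- Continuants

cont-cong : ∀ n (f g : ℕ → ℤ) → (∀ i → i ℕ.≤ n → f i ≡ g i) → cont n f ≡ cont n g
cont-cong zero f g f≗g = refl
cont-cong (suc zero) f g f≗g = f≗g 1 ℕₚ.≤-refl
cont-cong (suc (suc n)) f g f≗g =
  cong₂ _+_ (cong₂ _*_ (cont-cong (suc n) f g (λ i i≤ → f≗g i (ℕₚ.m≤n⇒m≤1+n i≤))) (f≗g _ ℕₚ.≤-refl))
            (cont-cong n f g (λ i i≤ → f≗g i (ℕₚ.m≤n⇒m≤1+n (ℕₚ.m≤n⇒m≤1+n i≤))))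

cont-unfoldˡ : ∀ n f → cont (suc (suc n)) f ≡ f 1 * cont (suc n) (f ∘ suc) + cont n (f ∘ suc ∘ suc)
cont-unfoldˡ zero f = refl
cont-unfoldˡ (suc zero) f = rearrange (f 1) (f 2) (f 3)
  where
  rearrange : ∀ a b c → (a * b + 1ℤ) * c + a ≡ a * (b * c + 1ℤ) + c
  rearrange = solve-∀
cont-unfoldˡ (suc (suc n)) f = begin
    cont (3+n) f * f 4+n + cont (2+n) f
  ≡⟨ cong₂ (λ a b → a * f 4+n + b) (cont-unfoldˡ (suc n) f) (cont-unfoldˡ n f) ⟩
    (f 1 * A₂ + B₁) * f 4+n + (f 1 * A₁ + B₀)
  ≡⟨ rearrange (f 1) A₂ A₁ B₁ B₀ (f 4+n) ⟩
    f 1 * (A₂ * f 4+n + A₁) + (B₁ * f 4+n + B₀) ∎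
  where
  open ≡-Reasoning
  2+n 3+n 4+n : ℕ
  2+n = suc (suc n)
  3+n = suc 2+n
  4+n = suc 3+n
  A₂ A₁ B₁ B₀ : ℤ
  A₂ = cont 2+n (f ∘ suc)
  A₁ = cont (suc n) (f ∘ suc)
  B₁ = cont (suc n) (f ∘ suc ∘ suc)
  B₀ = cont n (f ∘ suc ∘ suc)
  rearrange : ∀ a x y u v w → (a * x + u) * w + (a * y + v) ≡ a * (x * w + y) + (u * w + v)
  rearrange = solve-∀

cont-reverse : ∀ n f → cont n (λ i → f (suc n ∸ i)) ≡ cont n f
cont-reverse zero f = refl
cont-reverse (suc zero) f = refl
cont-reverse (suc (suc n)) f = begin
    cont (suc n) (λ i → f (3+n ∸ i)) * f (3+n ∸ 2+n) + cont n (λ i → f (3+n ∸ i))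
  ≡⟨ cong₂ _+_ (cong₂ _*_ (trans reindex₁ (cont-reverse (suc n) (f ∘ suc))) (cong f (ℕₚ.m+n∸n≡m 1 2+n)))
               (trans reindex₀ (cont-reverse n (f ∘ suc ∘ suc))) ⟩
    cont (suc n) (f ∘ suc) * f 1 + cont n (f ∘ suc ∘ suc)
  ≡⟨ cong (_+ cont n (f ∘ suc ∘ suc)) (*-comm (cont (suc n) (f ∘ suc)) (f 1)) ⟩
    f 1 * cont (suc n) (f ∘ suc) + cont n (f ∘ suc ∘ suc)
  ≡⟨ sym (cont-unfoldˡ n f) ⟩
    cont 2+n f ∎
  where
  open ≡-Reasoning
  2+n 3+n : ℕ
  2+n = suc (suc n)
  3+n = suc 2+n
  reindex₁ : cont (suc n) (λ i → f (3+n ∸ i)) ≡ cont (suc n) (λ i → f (suc (2+n ∸ i)))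
  reindex₁ = cont-cong (suc n) _ _ (λ i i≤ → cong f (ℕₚ.+-∸-assoc 1 (ℕₚ.m≤n⇒m≤1+n i≤)))
  reindex₀ : cont n (λ i → f (3+n ∸ i)) ≡ cont n (λ i → f (suc (suc (suc n ∸ i))))
  reindex₀ = cont-cong n _ _ (λ i i≤ → cong f (ℕₚ.+-∸-assoc 2 (ℕₚ.m≤n⇒m≤1+n i≤)))

^-periodic : ∀ e → e * e ≡ 1ℤ → ∀ n → e ^ suc (suc n) ≡ e ^ n
^-periodic e e²≡1 n = begin
  e * (e * e ^ n) ≡⟨ sym (*-assoc e e (e ^ n)) ⟩
  e * e * e ^ n   ≡⟨ cong (_* e ^ n) e²≡1 ⟩
  1ℤ * e ^ n      ≡⟨ *-identityˡ (e ^ n) ⟩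
  e ^ n           ∎
  where open ≡-Reasoning

cont-scale : ∀ e → e * e ≡ 1ℤ → ∀ n f → cont n (λ i → e * f i) ≡ e ^ n * cont n f
cont-scale e e²≡1 zero f = refl
cont-scale e e²≡1 (suc zero) f = cong (_* f 1) (sym (*-identityʳ e))
cont-scale e e²≡1 (suc (suc n)) f = begin
    cont (suc n) (λ i → e * f i) * (e * f 2+n) + cont n (λ i → e * f i)
  ≡⟨ cong₂ (λ a b → a * (e * f 2+n) + b) (cont-scale e e²≡1 (suc n) f) (cont-scale e e²≡1 n f) ⟩
    e * e ^ n * C₁ * (e * f 2+n) + e ^ n * C₀
  ≡⟨ rearrange e (e ^ n) C₁ C₀ (f 2+n) ⟩
    e ^ 2+n * (C₁ * f 2+n) + e ^ n * C₀
  ≡⟨ cong (λ p → p * (C₁ * f 2+n) + e ^ n * C₀) (^-periodic e e²≡1 n) ⟩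
    e ^ n * (C₁ * f 2+n) + e ^ n * C₀
  ≡⟨ sym (*-distribˡ-+ (e ^ n) (C₁ * f 2+n) C₀) ⟩
    e ^ n * (C₁ * f 2+n + C₀)
  ≡⟨ cong (_* (C₁ * f 2+n + C₀)) (sym (^-periodic e e²≡1 n)) ⟩
    e ^ 2+n * cont 2+n f ∎
  where
  open ≡-Reasoning
  2+n : ℕ
  2+n = suc (suc n)
  C₁ C₀ : ℤ
  C₁ = cont (suc n) f
  C₀ = cont n f
  rearrange : ∀ e p x y a → e * p * x * (e * a) + p * y ≡ e * (e * p) * (x * a) + p * y
  rearrange = solve-∀

cont-reverse-scale : ∀ e → e * e ≡ 1ℤ → ∀ n f → cont n (λ i → e * f (suc n ∸ i)) ≡ e ^ n * cont n f
cont-reverse-scale e e²≡1 n f =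
  trans (cont-scale e e²≡1 n (λ i → f (suc n ∸ i))) (cong (e ^ n *_) (cont-reverse n f))

prevCont : ℕ → (ℕ → ℤ) → ℤ
prevCont zero q = 0ℤ
prevCont (suc n) q = cont n q

cont-suc : ∀ n q → cont (suc n) q ≡ cont n q * q (suc n) + prevCont n q
cont-suc zero q = sym (trans (+-identityʳ (1ℤ * q 1)) (*-identityˡ (q 1)))
cont-suc (suc n) q = refl

cont-coprime : ∀ n q {d} → d ∣ₛ cont (suc n) q → d ∣ₛ cont n q → d ∣ₛ 1ℤ
cont-coprime zero q _ d∣1 = d∣1
cont-coprime (suc n) q d∣c₂ d∣c₁ =
  cont-coprime n q d∣c₁ (Signed.∣m+n∣m⇒∣n d∣c₂ (Signed.∣m⇒∣m*n (q (suc (suc n))) d∣c₁))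

gcd-cont : ∀ n q → gcd (cont (suc n) q) (cont n q) ≡ 1ℤ
gcd-cont n q =
  cong +_ (ℕ∣.∣1⇒≡1 (∣⇒∣ᵤ (cont-coprime n q {gcd x y} (∣ᵤ⇒∣ (gcd[i,j]∣i x y)) (∣ᵤ⇒∣ (gcd[i,j]∣j x y)))))
  where
  x y : ℤ
  x = cont (suc n) q
  y = cont n q

gcd-cong-abs : ∀ {x x′ y y′} → ∣ x ∣ ≡ ∣ x′ ∣ → ∣ y ∣ ≡ ∣ y′ ∣ → gcd x y ≡ gcd x′ y′
gcd-cong-abs ∣x∣≡ ∣y∣≡ = cong₂ (λ a b → + gcdℕ a b) ∣x∣≡ ∣y∣≡

unit-square : ∀ e → ∣ e ∣ ≡ 1 → e * e ≡ 1ℤ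
unit-square +[1+ zero ] _ = refl
unit-square -[1+ zero ] _ = refl
unit-square +0 ()
unit-square +[1+ suc _ ] ()
unit-square -[1+ suc _ ] ()

abs-unit-^ : ∀ e → ∣ e ∣ ≡ 1 → ∀ n → ∣ e ^ n ∣ ≡ 1
abs-unit-^ e ∣e∣≡1 zero = refl
abs-unit-^ e ∣e∣≡1 (suc n) = trans (abs-* e (e ^ n)) (cong₂ ℕ._*_ ∣e∣≡1 (abs-unit-^ e ∣e∣≡1 n))

abs-unit-* : ∀ e → ∣ e ∣ ≡ 1 → ∀ x → ∣ e * x ∣ ≡ ∣ x ∣
abs-unit-* e ∣e∣≡1 x = trans (abs-* e x) (trans (cong (ℕ._* ∣ x ∣) ∣e∣≡1) (ℕₚ.*-identityˡ ∣ x ∣))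

abs<⇒≢0 : ∀ {x y} → ∣ x ∣ ℕ.< ∣ y ∣ → y ≢ 0ℤ
abs<⇒≢0 ∣x∣<∣0∣ refl = ℕₚ.n≮0 ∣x∣<∣0∣

∣t*m∣<∣m∣⇒t≡0 : ∀ t m → ∣ t * m ∣ ℕ.< ∣ m ∣ → t ≡ 0ℤ
∣t*m∣<∣m∣⇒t≡0 t m ∣tm∣<∣m∣ = ∣i∣≡0⇒i≡0 (ℕₚ.n<1⇒n≡0 (ℕₚ.*-cancelʳ-< ∣ m ∣ ∣ t ∣ 1
  (subst₂ ℕ._<_ (abs-* t m) (sym (ℕₚ.*-identityˡ ∣ m ∣)) ∣tm∣<∣m∣)))

exact-quotient : ∀ {a r d m} → a ≡ r + d * m → m ∣ₛ a → ∣ r ∣ ℕ.< ∣ m ∣ → d * m ≡ a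
exact-quotient {a} {r} {d} {m} a≡r+dm (divides q a≡qm) ∣r∣<∣m∣ = begin
  d * m          ≡⟨ sym (+-identityˡ (d * m)) ⟩
  0ℤ + d * m     ≡⟨ cong (_+ d * m) (sym r≡0) ⟩
  r + d * m      ≡⟨ sym a≡r+dm ⟩
  a              ∎
  where
  open ≡-Reasoning
  r≡[q-d]m : r ≡ (q - d) * m
  r≡[q-d]m = begin
    r                     ≡⟨ cancel r (d * m) ⟩
    (r + d * m) - d * m   ≡⟨ cong (_- d * m) (trans (sym a≡r+dm) a≡qm) ⟩
    q * m - d * m         ≡⟨ factor q d m ⟩
    (q - d) * m           ∎
    where
    cancel : ∀ x y → x ≡ (x + y) - y
    cancel = solve-∀
    factor : ∀ q d m → q * m - d * m ≡ (q - d) * m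
    factor = solve-∀
  r≡0 : r ≡ 0ℤ
  r≡0 = trans r≡[q-d]m
          (cong (_* m) (∣t*m∣<∣m∣⇒t≡0 (q - d) m (subst (λ x → ∣ x ∣ ℕ.< ∣ m ∣) r≡[q-d]m ∣r∣<∣m∣)))

divℤ-exact : ∀ {a m} → m ≢ 0ℤ → m ∣ₛ a → divℤ a m * m ≡ a
divℤ-exact {m = +0} m≢0 _ = ⊥-elim (m≢0 refl)
divℤ-exact {a} {m@(+[1+ _ ])} _ m∣a =
  exact-quotient {r = + (a % m)} {d = a / m} (a≡a%n+[a/n]*n a m) m∣a (n%d<d a m)
divℤ-exact {a} {m@(-[1+ _ ])} _ m∣a =
  exact-quotient {r = + (a % m)} {d = a / m} (a≡a%n+[a/n]*n a m) m∣a (n%d<d a m)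

∣1+a-1+n∣<1+n : ∀ {a n} → suc a ℕ.< suc n → ∣ +[1+ a ] - +[1+ n ] ∣ ℕ.< suc n
∣1+a-1+n∣<1+n {a} {n} a<n = subst (ℕ._< suc n) (sym (∣⊖∣-< a<n)) (s≤s (ℕₚ.m∸n≤m n a))

nonzero-quotient : ∀ {z m} → 0ℤ < z → ∣ z ∣ ℕ.< ∣ m ∣ → ∃[ t ] (t ≢ 0ℤ × ∣ z - t * m ∣ ℕ.< ∣ m ∣)
nonzero-quotient {+0} (+<+ ()) _
nonzero-quotient {+[1+ a ]} {+0} _ ()
nonzero-quotient {z@(+[1+ a ])} {m@(+[1+ n ])} _ a<n =
  + 1 , (λ ()) , subst (λ x → ∣ x ∣ ℕ.< suc n) (cong (λ w → z - w) (sym (*-identityˡ m))) (∣1+a-1+n∣<1+n a<n)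
nonzero-quotient {z@(+[1+ a ])} {m@(-[1+ n ])} _ a<n =
  -1ℤ , (λ ()) , subst (λ x → ∣ x ∣ ℕ.< suc n) (cong (λ w → z - w) (sym (-1*i≡-i m))) (∣1+a-1+n∣<1+n a<n)

-- Binary quadratic forms

form : ℤ → ℤ → ℤ → ℤ → ℤ → ℤ
form a b c x y = a * (x * x) + b * (x * y) + c * (y * y)

form-homogeneous : ∀ a b c p x y → form a b c (p * x) (p * y) ≡ (p * p) * form a b c x y
form-homogeneous = homogeneity
  where
  homogeneity : ∀ a b c p x y →
    a * ((p * x) * (p * x)) + b * ((p * x) * (p * y)) + c * ((p * y) * (p * y)) ≡
    (p * p) * (a * (x * x) + b * (x * y) + c * (y * y))
  homogeneity = solve-∀

form-substitutionₗ : ∀ b c m m′ z u v → m′ * m ≡ form (+ 1) b c z (+ 1) →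
  form (+ 1) b c (m * u + z * v) v ≡ m * form m (z + z + b) m′ u v
form-substitutionₗ b c m m′ z u v m′m≡Q = begin
    form (+ 1) b c (m * u + z * v) v
  ≡⟨ expand b c m z u v ⟩
    m * (m * (u * u) + (z + z + b) * (u * v)) + form (+ 1) b c z (+ 1) * (v * v)
  ≡⟨ cong (λ t → m * (m * (u * u) + (z + z + b) * (u * v)) + t * (v * v)) (sym m′m≡Q) ⟩
    m * (m * (u * u) + (z + z + b) * (u * v)) + m′ * m * (v * v)
  ≡⟨ collect m m′ (z + z + b) u v ⟩
    m * form m (z + z + b) m′ u v ∎
  where
  open ≡-Reasoning
  expand : ∀ b c m z u v →
    + 1 * ((m * u + z * v) * (m * u + z * v)) + b * ((m * u + z * v) * v) + c * (v * v) ≡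
    m * (m * (u * u) + (z + z + b) * (u * v)) + (+ 1 * (z * z) + b * (z * + 1) + c * (+ 1 * + 1)) * (v * v)
  expand = solve-∀
  collect : ∀ m m′ s u v →
    m * (m * (u * u) + s * (u * v)) + m′ * m * (v * v) ≡ m * (m * (u * u) + s * (u * v) + m′ * (v * v))
  collect = solve-∀

form-substitutionᵣ : ∀ b c m m′ z u v → m′ * m ≡ form (+ 1) b c z (+ 1) →
  form (+ 1) b c (z * u + m′ * v) u ≡ m′ * form m (z + z + b) m′ u v
form-substitutionᵣ b c m m′ z u v m′m≡Q = begin
    form (+ 1) b c (z * u + m′ * v) u
  ≡⟨ expand b c m′ z u v ⟩
    form (+ 1) b c z (+ 1) * (u * u) + m′ * ((z + z + b) * (u * v) + m′ * (v * v))
  ≡⟨ cong (λ t → t * (u * u) + m′ * ((z + z + b) * (u * v) + m′ * (v * v))) (sym m′m≡Q) ⟩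
    m′ * m * (u * u) + m′ * ((z + z + b) * (u * v) + m′ * (v * v))
  ≡⟨ collect m m′ (z + z + b) u v ⟩
    m′ * form m (z + z + b) m′ u v ∎
  where
  open ≡-Reasoning
  expand : ∀ b c m′ z u v →
    + 1 * ((z * u + m′ * v) * (z * u + m′ * v)) + b * ((z * u + m′ * v) * u) + c * (u * u) ≡
    (+ 1 * (z * z) + b * (z * + 1) + c * (+ 1 * + 1)) * (u * u) + m′ * ((z + z + b) * (u * v) + m′ * (v * v))
  expand = solve-∀
  collect : ∀ m m′ s u v →
    m′ * m * (u * u) + m′ * (s * (u * v) + m′ * (v * v)) ≡ m′ * (m * (u * u) + s * (u * v) + m′ * (v * v))
  collect = solve-∀

form-transfer : ∀ b c m m′ z N u v → m ≢ 0ℤ → m′ * m ≡ form (+ 1) b c z (+ 1) →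
  form (+ 1) b c (m * u + z * v) v ≡ N * m → form (+ 1) b c (z * u + m′ * v) u ≡ N * m′
form-transfer b c m m′ z N u v m≢0 m′m≡Q value≡Nm = begin
  form (+ 1) b c (z * u + m′ * v) u ≡⟨ form-substitutionᵣ b c m m′ z u v m′m≡Q ⟩
  m′ * F                            ≡⟨ cong (m′ *_) F≡N ⟩
  m′ * N                            ≡⟨ *-comm m′ N ⟩
  N * m′                            ∎
  where
  open ≡-Reasoning
  F : ℤ
  F = form m (z + z + b) m′ u v
  F≡N : F ≡ N
  F≡N = *-cancelˡ-≡ m F N {{≢-nonZero m≢0}}
          (trans (sym (form-substitutionₗ b c m m′ z u v m′m≡Q)) (trans value≡Nm (*-comm N m)))

form-divides-shift : ∀ b c {m m′ z z′} t → m′ * m ≡ form (+ 1) b c z (+ 1) → z ≡ t * m′ + z′ →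
  m′ ∣ₛ form (+ 1) b c z′ (+ 1)
form-divides-shift b c {m} {m′} {z} {z′} t m′m≡Q z≡tm′+z′ = divides (m - s) (begin
    form (+ 1) b c z′ (+ 1)
  ≡⟨ shift b c t m′ z′ ⟩
    form (+ 1) b c (t * m′ + z′) (+ 1) - m′ * s
  ≡⟨ cong (λ w → form (+ 1) b c w (+ 1) - m′ * s) (sym z≡tm′+z′) ⟩
    form (+ 1) b c z (+ 1) - m′ * s
  ≡⟨ cong (_- m′ * s) (sym m′m≡Q) ⟩
    m′ * m - m′ * s
  ≡⟨ factor m′ m s ⟩
    (m - s) * m′ ∎)
  where
  open ≡-Reasoning
  s : ℤ
  s = t * t * m′ + (t * z′ + t * z′) + b * t
  shift : ∀ b c t m′ z′ →
    + 1 * (z′ * z′) + b * (z′ * + 1) + c * (+ 1 * + 1) ≡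
    (+ 1 * ((t * m′ + z′) * (t * m′ + z′)) + b * ((t * m′ + z′) * + 1) + c * (+ 1 * + 1))
      - m′ * (t * t * m′ + (t * z′ + t * z′) + b * t)
  shift = solve-∀
  factor : ∀ m′ m s → m′ * m - m′ * s ≡ (m - s) * m′
  factor = solve-∀

-- Descent for the principal forms of class number one

-- Since m′ m = Q(z, 1) at each step, this says |m| decreases strictly, except at the single residue
-- z = c, where it may stay constant.
Descent : (ℤ → ℤ → ℤ) → ℤ → Set
Descent Q c = ∀ {m z} → m ∣ₛ Q z (+ 1) → 2 ℕ.≤ ∣ m ∣ → ∣ z ∣ ℕ.< ∣ m ∣ →
  ∣ Q z (+ 1) ∣ ℕ.< ∣ m ∣ ℕ.* ∣ m ∣ ⊎ (∣ Q z (+ 1) ∣ ≡ ∣ m ∣ ℕ.* ∣ m ∣ × z ≡ c × 0ℤ < c)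

principalValue : ℕ → ℕ → ℕ → ℕ
principalValue b h w = w ℕ.* w ℕ.+ b ℕ.* w ℕ.+ h

principalValue<square : ∀ {b h w M} → b ℕ.≤ 1 → w ℕ.< M → h ℕ.< M → principalValue b h w ℕ.< M ℕ.* M
principalValue<square {b} {h} {w} {M} b≤1 w<M h<M = begin-strict
    w ℕ.* w ℕ.+ b ℕ.* w ℕ.+ h
  ≤⟨ ℕₚ.+-monoˡ-≤ h (ℕₚ.+-monoʳ-≤ (w ℕ.* w) bw≤w) ⟩
    w ℕ.* w ℕ.+ w ℕ.+ h
  <⟨ ℕₚ.+-monoʳ-< (w ℕ.* w ℕ.+ w) h<M ⟩
    w ℕ.* w ℕ.+ w ℕ.+ M
  ≡⟨ cong (ℕ._+ M) (trans (ℕₚ.+-comm (w ℕ.* w) w) (sym (ℕₚ.*-suc w w))) ⟩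
    w ℕ.* suc w ℕ.+ M
  ≤⟨ ℕₚ.+-monoˡ-≤ M (ℕₚ.*-monoʳ-≤ w w<M) ⟩
    w ℕ.* M ℕ.+ M
  ≡⟨ ℕₚ.+-comm (w ℕ.* M) M ⟩
    suc w ℕ.* M
  ≤⟨ ℕₚ.*-monoˡ-≤ M w<M ⟩
    M ℕ.* M ∎
  where
  open ℕₚ.≤-Reasoning
  bw≤w : b ℕ.* w ℕ.≤ w
  bw≤w = ℕₚ.≤-trans (ℕₚ.*-monoˡ-≤ w b≤1) (ℕₚ.≤-reflexive (ℕₚ.*-identityˡ w))

-- For b = 1, w = h - 1 gives w² + w + h = h², so equality does occur at M = h.
Exceptional : ℕ → ℕ → ℕ → ℕ → Set
Exceptional b h M w = b ≡ 1 × w ≡ h ∸ 1 × M ≡ h × principalValue b h w ≡ M ℕ.* M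

-- By principalValue<square only moduli M ≤ h matter; checking them is a finite computation, and it is
-- here that class number one is used.
SmallModuli : ℕ → ℕ → Set
SmallModuli b h = ∀ {M} → M ℕ.< suc h → ∀ {w} → w ℕ.< M → 2 ℕ.≤ M → M ℕ∣.∣ principalValue b h w →
  principalValue b h w ℕ.< M ℕ.* M ⊎ Exceptional b h M w

smallModuli? : ∀ b h → Dec (SmallModuli b h)
smallModuli? b h = ℕₚ.allUpTo? (λ M → ℕₚ.allUpTo? (λ w →
  2 ℕₚ.≤? M →-dec M ℕ∣.∣? principalValue b h w →-dec
    (principalValue b h w ℕₚ.<? M ℕ.* M ⊎-dec
     (b ℕₚ.≟ 1 ×-dec w ℕₚ.≟ h ∸ 1 ×-dec M ℕₚ.≟ h ×-dec principalValue b h w ℕₚ.≟ M ℕ.* M))) M) (suc h)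

descentℕ : ∀ {b h} → b ℕ.≤ 1 → SmallModuli b h → ∀ {M w} → 2 ℕ.≤ M → w ℕ.< M →
  M ℕ∣.∣ principalValue b h w → principalValue b h w ℕ.< M ℕ.* M ⊎ Exceptional b h M w
descentℕ {b} {h} b≤1 small {M} 2≤M w<M M∣value with h ℕₚ.<? M
... | yes h<M = inj₁ (principalValue<square b≤1 w<M h<M)
... | no h≮M = small (s≤s (ℕₚ.≮⇒≥ h≮M)) w<M 2≤M M∣value

pos-principalValue : ∀ b h w → + principalValue b h w ≡ + w * + w + + b * + w + + h
pos-principalValue b h w =
  trans (pos-+ (w ℕ.* w ℕ.+ b ℕ.* w) h)
        (cong (_+ + h) (trans (pos-+ (w ℕ.* w) (b ℕ.* w)) (cong₂ _+_ (pos-* w w) (pos-* b w))))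

NaturalRepresentative : ℕ → ℤ → ℕ → Set
NaturalRepresentative b z w = z ≡ + w ⊎ ∣ z ∣ ≡ b ℕ.+ w

-- Q(z, 1) = Q(-z - b, 1), so every value Q(z, 1) is already taken at a natural number w.
principalValue-of : ∀ {b} → b ℕ.≤ 1 → ∀ h z →
  ∃[ w ] (form (+ 1) (+ b) (+ h) z (+ 1) ≡ + principalValue b h w × NaturalRepresentative b z w)
principalValue-of {b} _ h (+ a) =
  a , trans (atNatural (+ a) (+ b) (+ h)) (sym (pos-principalValue b h a)) , inj₁ refl
  where
  atNatural : ∀ a b h → + 1 * (a * a) + b * (a * + 1) + h * (+ 1 * + 1) ≡ a * a + b * a + h
  atNatural = solve-∀
principalValue-of z≤n h -[1+ a ] =
  suc a , trans (reflect (+ a) (+ h)) (sym (pos-principalValue 0 h (suc a))) , inj₂ refl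
  where
  reflect : ∀ a h →
    + 1 * (- (+ 1 + a) * - (+ 1 + a)) + + 0 * (- (+ 1 + a) * + 1) + h * (+ 1 * + 1) ≡
    (+ 1 + a) * (+ 1 + a) + + 0 * (+ 1 + a) + h
  reflect = solve-∀
principalValue-of (s≤s z≤n) h -[1+ a ] =
  a , trans (reflect (+ a) (+ h)) (sym (pos-principalValue 1 h a)) , inj₂ refl
  where
  reflect : ∀ a h →
    + 1 * (- (+ 1 + a) * - (+ 1 + a)) + + 1 * (- (+ 1 + a) * + 1) + h * (+ 1 * + 1) ≡ a * a + + 1 * a + h
  reflect = solve-∀

≤-abs-of-representative : ∀ {b w z} → NaturalRepresentative b z w → w ℕ.≤ ∣ z ∣
≤-abs-of-representative (inj₁ refl) = ℕₚ.≤-refl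
≤-abs-of-representative {b} {w} (inj₂ ∣z∣≡b+w) = subst (w ℕ.≤_) (sym ∣z∣≡b+w) (ℕₚ.m≤n+m w b)

exceptional-residue : ∀ {b h M w z} → NaturalRepresentative b z w → ∣ z ∣ ℕ.< M → Exceptional b h M w →
  z ≡ + (h ∸ 1)
exceptional-residue (inj₁ z≡w) _ (_ , w≡h-1 , _) = trans z≡w (cong +_ w≡h-1)
exceptional-residue {h = h} (inj₂ ∣z∣≡1+w) ∣z∣<h (refl , refl , refl , _) =
  ⊥-elim (ℕₚ.<⇒≱ ∣z∣<h (subst (h ℕ.≤_) (sym ∣z∣≡1+w) (ℕₚ.m≤n+m∸n h 1)))

descent : ∀ {b h} → b ℕ.≤ 1 → SmallModuli b h → Descent (form (+ 1) (+ b) (+ h)) (+ (h ∸ 1))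
descent {b} {h} b≤1 small {m} {z} m∣Q 2≤∣m∣ ∣z∣<∣m∣ = fromRepresentative (principalValue-of b≤1 h z)
  where
  fromRepresentative :
    ∃[ w ] (form (+ 1) (+ b) (+ h) z (+ 1) ≡ + principalValue b h w × NaturalRepresentative b z w) →
    ∣ form (+ 1) (+ b) (+ h) z (+ 1) ∣ ℕ.< ∣ m ∣ ℕ.* ∣ m ∣ ⊎
    (∣ form (+ 1) (+ b) (+ h) z (+ 1) ∣ ≡ ∣ m ∣ ℕ.* ∣ m ∣ × z ≡ + (h ∸ 1) × 0ℤ < + (h ∸ 1))
  fromRepresentative (w , Q≡value , z≈w)
    with descentℕ b≤1 small 2≤∣m∣ (ℕₚ.≤-<-trans (≤-abs-of-representative z≈w) ∣z∣<∣m∣)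
                  (subst (∣ m ∣ ℕ∣.∣_) (cong ∣_∣ Q≡value) (∣⇒∣ᵤ m∣Q))
  ... | inj₁ value<M² = inj₁ (subst (ℕ._< ∣ m ∣ ℕ.* ∣ m ∣) (sym (cong ∣_∣ Q≡value)) value<M²)
  ... | inj₂ exceptional@(_ , _ , M≡h , value≡M²) =
    inj₂ (trans (cong ∣_∣ Q≡value) value≡M² , exceptional-residue z≈w ∣z∣<∣m∣ exceptional ,
          +<+ (ℕₚ.m<n⇒0<n∸m (subst (2 ℕ.≤_) M≡h 2≤∣m∣)))

odd-principal : ∀ h x y → x * x + x * y + + h * (y * y) ≡ form (+ 1) (+ 1) (+ h) x y
odd-principal h x y = normalise x y (+ h)
  where
  normalise : ∀ x y h → x * x + x * y + h * (y * y) ≡ + 1 * (x * x) + + 1 * (x * y) + h * (y * y)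
  normalise = solve-∀

even-principal : ∀ h x y → x * x + + h * (y * y) ≡ form (+ 1) (+ 0) (+ h) x y
even-principal h x y = normalise x y (+ h)
  where
  normalise : ∀ x y h → x * x + h * (y * y) ≡ + 1 * (x * x) + + 0 * (x * y) + h * (y * y)
  normalise = solve-∀

classNumberOne-principalForm : ∀ {Δ} → Δ ∈ classNumberOneDiscs →
  ∃[ b ] ∃[ h ] (b ℕ.≤ 1 × (∀ x y → Qform Δ x y ≡ form (+ 1) (+ b) (+ h) x y) × SmallModuli b h)
classNumberOne-principalForm (here refl) =
  1 , 1 , ℕₚ.≤-refl , odd-principal 1 , toWitness {a? = smallModuli? 1 1} _
classNumberOne-principalForm (there (here refl)) =
  0 , 1 , z≤n , even-principal 1 , toWitness {a? = smallModuli? 0 1} _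
classNumberOne-principalForm (there (there (here refl))) =
  1 , 2 , ℕₚ.≤-refl , odd-principal 2 , toWitness {a? = smallModuli? 1 2} _
classNumberOne-principalForm (there (there (there (here refl)))) =
  0 , 2 , z≤n , even-principal 2 , toWitness {a? = smallModuli? 0 2} _
classNumberOne-principalForm (there (there (there (there (here refl))))) =
  1 , 3 , ℕₚ.≤-refl , odd-principal 3 , toWitness {a? = smallModuli? 1 3} _
classNumberOne-principalForm (there (there (there (there (there (here refl)))))) =
  1 , 5 , ℕₚ.≤-refl , odd-principal 5 , toWitness {a? = smallModuli? 1 5} _
classNumberOne-principalForm (there (there (there (there (there (there (here refl))))))) =
  1 , 11 , ℕₚ.≤-refl , odd-principal 11 , toWitness {a? = smallModuli? 1 11} _
classNumberOne-principalForm (there (there (there (there (there (there (there (here refl)))))))) =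
  1 , 17 , ℕₚ.≤-refl , odd-principal 17 , toWitness {a? = smallModuli? 1 17} _
classNumberOne-principalForm (there (there (there (there (there (there (there (there (here refl))))))))) =
  1 , 41 , ℕₚ.≤-refl , odd-principal 41 , toWitness {a? = smallModuli? 1 41} _

-- The procedure

module Procedure {Δ B H c : ℤ} (Q≡ : ∀ x y → Qform Δ x y ≡ form (+ 1) B H x y)
  (descent : Descent (form (+ 1) B H) c) {m z k : ℕ → ℤ} (1<∣m₀∣ : 1 ℕ.< ∣ m 0 ∣)
  (∣z₀∣<∣m₀∣ : ∣ z 0 ∣ ℕ.< ∣ m 0 ∣) (m₀∣Q : m 0 ∣ₛ form (+ 1) B H (z 0) (+ 1))
  (step : ∀ s → Running m s → StepOK Δ m z k s) where

  Q : ℤ → ℤ → ℤ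
  Q = form (+ 1) B H

  Before : ℕ → Set
  Before T = ∀ j → j ℕ.< T → ∣ m j ∣ ≢ 1

  before-suc : ∀ {s} → Before s → ∣ m s ∣ ≢ 1 → Before (suc s)
  before-suc before ∣m∣≢1 j j<1+s with ℕₚ.m<1+n⇒m<n∨m≡n j<1+s
  ... | inj₁ j<s = before j j<s
  ... | inj₂ refl = ∣m∣≢1

  running : ∀ {s} → Before (suc s) → Running m s
  running before j j≤s = before j (s≤s j≤s)

  -- The last component becomes the representation Q(x, y) = m₀ m_T of the theorem once z_T = 0.
  Invariant : ℕ → Set
  Invariant s = m s ∣ₛ Q (z s) (+ 1) × ∣ z s ∣ ℕ.< ∣ m s ∣ ×
                Q (m s * cont s k + z s * prevCont s k) (prevCont s k) ≡ m 0 * m s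

  invariant-zero : Invariant 0
  invariant-zero = m₀∣Q , ∣z₀∣<∣m₀∣ , initial B H (m 0) (z 0)
    where
    initial : ∀ B H m z →
      + 1 * ((m * + 1 + z * + 0) * (m * + 1 + z * + 0)) + B * ((m * + 1 + z * + 0) * + 0) + H * (+ 0 * + 0)
        ≡ m * m
    initial = solve-∀

  m≢0 : ∀ {s} → Invariant s → m s ≢ 0ℤ
  m≢0 {s} (_ , ∣z∣<∣m∣ , _) = abs<⇒≢0 {z s} ∣z∣<∣m∣

  norm-factor : ∀ {s} → Invariant s → StepOK Δ m z k s → m (suc s) * m s ≡ Q (z s) (+ 1)
  norm-factor {s} inv@(m∣Q , _ , _) (m′≡ , _) = begin
    m (suc s) * m s                         ≡⟨ cong (_* m s) m′≡ ⟩
    divℤ (Qform Δ (z s) (+ 1)) (m s) * m s  ≡⟨ cong (λ a → divℤ a (m s) * m s) (Q≡ (z s) (+ 1)) ⟩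
    divℤ (Q (z s) (+ 1)) (m s) * m s        ≡⟨ divℤ-exact (m≢0 inv) m∣Q ⟩
    Q (z s) (+ 1)                           ∎
    where open ≡-Reasoning

  invariant-suc : ∀ {s} → Invariant s → StepOK Δ m z k s → Invariant (suc s)
  invariant-suc {s} inv@(_ , _ , represents) st@(_ , z≡km′+z′ , ∣z′∣<∣m′∣ , _) =
    form-divides-shift B H k′ factor z≡km′+z′ , ∣z′∣<∣m′∣ , represents′
    where
    open ≡-Reasoning
    m′ z′ k′ u v : ℤ
    m′ = m (suc s)
    z′ = z (suc s)
    k′ = k (suc s)
    u = cont s k
    v = prevCont s k
    factor : m′ * m s ≡ Q (z s) (+ 1)
    factor = norm-factor inv st
    rearrange : ∀ m′ u v k′ z′ → m′ * (u * k′ + v) + z′ * u ≡ (k′ * m′ + z′) * u + m′ * v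
    rearrange = solve-∀
    represents′ : Q (m′ * cont (suc s) k + z′ * u) u ≡ m 0 * m′
    represents′ = begin
      Q (m′ * cont (suc s) k + z′ * u) u  ≡⟨ cong (λ w → Q (m′ * w + z′ * u) u) (cont-suc s k) ⟩
      Q (m′ * (u * k′ + v) + z′ * u) u    ≡⟨ cong (λ w → Q w u) (rearrange m′ u v k′ z′) ⟩
      Q ((k′ * m′ + z′) * u + m′ * v) u   ≡⟨ cong (λ w → Q (w * u + m′ * v) u) (sym z≡km′+z′) ⟩
      Q (z s * u + m′ * v) u
        ≡⟨ form-transfer B H (m s) m′ (z s) (m 0) u v (m≢0 inv) factor represents ⟩
      m 0 * m′                            ∎

  invariant : ∀ s → Before s → Invariant s
  invariant zero _ = invariant-zero
  invariant (suc s) before =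
    invariant-suc (invariant s (λ j j<s → before j (ℕₚ.m<n⇒m<1+n j<s))) (step s (running before))

  atResidue : ℤ → ℕ
  atResidue x = if does (x ≟ c) then 1 else 0

  atResidue≤1 : ∀ x → atResidue x ℕ.≤ 1
  atResidue≤1 x with does (x ≟ c)
  ... | true = ℕₚ.≤-refl
  ... | false = z≤n

  atResidue-≡ : ∀ {x} → x ≡ c → atResidue x ≡ 1
  atResidue-≡ {x} x≡c = cong (λ b → if b then 1 else 0) (dec-true (x ≟ c) x≡c)

  atResidue-≢ : ∀ {x} → x ≢ c → atResidue x ≡ 0
  atResidue-≢ {x} x≢c = cong (λ b → if b then 1 else 0) (dec-false (x ≟ c) x≢c)

  -- The second summand pays for the one step at which |m| may stay constant.
  measure : ℕ → ℕ
  measure s = 2 ℕ.* ∣ m s ∣ ℕ.+ atResidue (z s)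

  measure-shrinks : ∀ {s} → ∣ m (suc s) ∣ ℕ.< ∣ m s ∣ → measure (suc s) ℕ.< measure s
  measure-shrinks {s} ∣m′∣<∣m∣ = begin-strict
      2 ℕ.* ∣ m (suc s) ∣ ℕ.+ atResidue (z (suc s))
    ≤⟨ ℕₚ.+-monoʳ-≤ (2 ℕ.* ∣ m (suc s) ∣) (atResidue≤1 (z (suc s))) ⟩
      2 ℕ.* ∣ m (suc s) ∣ ℕ.+ 1
    <⟨ ℕₚ.n<1+n _ ⟩
      suc (2 ℕ.* ∣ m (suc s) ∣ ℕ.+ 1)
    ≡⟨ cong suc (ℕₚ.+-comm (2 ℕ.* ∣ m (suc s) ∣) 1) ⟩
      2 ℕ.+ 2 ℕ.* ∣ m (suc s) ∣
    ≡⟨ sym (ℕₚ.*-suc 2 ∣ m (suc s) ∣) ⟩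
      2 ℕ.* suc ∣ m (suc s) ∣
    ≤⟨ ℕₚ.*-monoʳ-≤ 2 ∣m′∣<∣m∣ ⟩
      2 ℕ.* ∣ m s ∣
    ≤⟨ ℕₚ.m≤m+n (2 ℕ.* ∣ m s ∣) (atResidue (z s)) ⟩
      measure s ∎
    where open ℕₚ.≤-Reasoning

  measure-leaves-residue : ∀ {s} → ∣ m (suc s) ∣ ≡ ∣ m s ∣ → z (suc s) ≢ c → z s ≡ c →
    measure (suc s) ℕ.< measure s
  measure-leaves-residue {s} ∣m′∣≡∣m∣ z′≢c z≡c = begin-strict
      2 ℕ.* ∣ m (suc s) ∣ ℕ.+ atResidue (z (suc s))
    ≡⟨ cong₂ (λ a b → 2 ℕ.* a ℕ.+ b) ∣m′∣≡∣m∣ (atResidue-≢ z′≢c) ⟩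
      2 ℕ.* ∣ m s ∣ ℕ.+ 0
    <⟨ ℕₚ.+-monoʳ-< (2 ℕ.* ∣ m s ∣) (s≤s z≤n) ⟩
      2 ℕ.* ∣ m s ∣ ℕ.+ 1
    ≡⟨ cong (2 ℕ.* ∣ m s ∣ ℕ.+_) (sym (atResidue-≡ z≡c)) ⟩
      measure s ∎
    where open ℕₚ.≤-Reasoning

  two≤∣m∣ : ∀ {s} → Invariant s → ∣ m s ∣ ≢ 1 → 2 ℕ.≤ ∣ m s ∣
  two≤∣m∣ (_ , ∣z∣<∣m∣ , _) ∣m∣≢1 = ℕₚ.≤∧≢⇒< (ℕₚ.≤-<-trans z≤n ∣z∣<∣m∣) (∣m∣≢1 ∘ sym)

  abs-norm-factor : ∀ {s} → Invariant s → StepOK Δ m z k s → ∣ m (suc s) ∣ ℕ.* ∣ m s ∣ ≡ ∣ Q (z s) (+ 1) ∣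
  abs-norm-factor {s} inv st = trans (sym (abs-* (m (suc s)) (m s))) (cong ∣_∣ (norm-factor inv st))

  nonzero-k : ∀ {s} → StepOK Δ m z k s → 0ℤ < z s → ∣ z s ∣ ℕ.< ∣ m (suc s) ∣ → k (suc s) ≢ 0ℤ
  nonzero-k (_ , _ , _ , inj₁ k≢0) _ _ = k≢0
  nonzero-k (_ , _ , _ , inj₂ onlyZero) 0<z ∣z∣<∣m′∣ =
    let t , t≢0 , remainder = nonzero-quotient 0<z ∣z∣<∣m′∣ in ⊥-elim (onlyZero t t≢0 remainder)

  leaves-residue : ∀ {s} → Invariant s → StepOK Δ m z k s → ∣ m (suc s) ∣ ≡ ∣ m s ∣ → z s ≡ c → 0ℤ < c →
    z (suc s) ≢ c
  leaves-residue {s} (_ , ∣z∣<∣m∣ , _) st@(_ , z≡km′+z′ , ∣z′∣<∣m′∣ , _) ∣m′∣≡∣m∣ z≡c 0<c z′≡c =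
    [ nonzero-k st (subst (0ℤ <_) (sym z≡c) 0<c) (subst (∣ z s ∣ ℕ.<_) (sym ∣m′∣≡∣m∣) ∣z∣<∣m∣)
    , abs<⇒≢0 {z (suc s)} ∣z′∣<∣m′∣ ]′ (i*j≡0⇒i≡0∨j≡0 (k (suc s)) km′≡0)
    where
    open ≡-Reasoning
    cancel : ∀ a b → a ≡ (a + b) - b
    cancel = solve-∀
    km′≡0 : k (suc s) * m (suc s) ≡ 0ℤ
    km′≡0 = begin
      k (suc s) * m (suc s)                           ≡⟨ cancel (k (suc s) * m (suc s)) (z (suc s)) ⟩
      (k (suc s) * m (suc s) + z (suc s)) - z (suc s) ≡⟨ cong₂ _-_ (sym z≡km′+z′) (trans z′≡c (sym z≡c)) ⟩
      z s - z s                                       ≡⟨ +-inverseʳ (z s) ⟩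
      0ℤ                                              ∎

  measure-decreases : ∀ {s} → Invariant s → StepOK Δ m z k s → ∣ m s ∣ ≢ 1 → measure (suc s) ℕ.< measure s
  measure-decreases {s} inv@(m∣Q , ∣z∣<∣m∣ , _) st ∣m∣≢1 with descent m∣Q (two≤∣m∣ inv ∣m∣≢1) ∣z∣<∣m∣
  ... | inj₁ Q<M² = measure-shrinks (ℕₚ.*-cancelʳ-< (∣ m s ∣) (∣ m (suc s) ∣) (∣ m s ∣)
                      (subst (ℕ._< ∣ m s ∣ ℕ.* ∣ m s ∣) (sym (abs-norm-factor inv st)) Q<M²))
  ... | inj₂ (Q≡M² , z≡c , 0<c) =
    measure-leaves-residue ∣m′∣≡∣m∣ (leaves-residue inv st ∣m′∣≡∣m∣ z≡c 0<c) z≡c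
    where
    ∣m′∣≡∣m∣ : ∣ m (suc s) ∣ ≡ ∣ m s ∣
    ∣m′∣≡∣m∣ = ℕₚ.*-cancelʳ-≡ (∣ m (suc s) ∣) (∣ m s ∣) (∣ m s ∣)
                 {{>-nonZeroℕ (ℕₚ.<-≤-trans (s≤s z≤n) (two≤∣m∣ inv ∣m∣≢1))}}
                 (trans (abs-norm-factor inv st) Q≡M²)

  terminates : ∃[ T ] (Before T × ∣ m T ∣ ≡ 1)
  terminates = run 0 (<-wellFounded (measure 0)) (λ _ ())
    where
    run : ∀ s → Acc ℕ._<_ (measure s) → Before s → ∃[ T ] (Before T × ∣ m T ∣ ≡ 1)
    run s (acc smaller) before with ∣ m s ∣ ℕₚ.≟ 1
    ... | yes ∣m∣≡1 = s , before , ∣m∣≡1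
    ... | no ∣m∣≢1 = run (suc s) (smaller decreases) before′
      where
      before′ : Before (suc s)
      before′ = before-suc before ∣m∣≢1
      decreases : measure (suc s) ℕ.< measure s
      decreases = measure-decreases (invariant s before) (step s (running before′)) ∣m∣≢1

  module AtTermination {t} (before : Before (suc t)) (∣e∣≡1 : ∣ m (suc t) ∣ ≡ 1) where

    e : ℤ
    e = m (suc t)

    x y : ℤ
    x = cont (suc t) (λ i → e * k (suc (suc t) ∸ i))
    y = cont t (λ i → e * k (suc t ∸ i))

    x≡ : x ≡ e ^ suc t * cont (suc t) k
    x≡ = cont-reverse-scale e (unit-square e ∣e∣≡1) (suc t) k

    y≡ : y ≡ e ^ t * cont t k
    y≡ = cont-reverse-scale e (unit-square e ∣e∣≡1) t k

    z≡0 : z (suc t) ≡ 0ℤ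
    z≡0 = ∣i∣≡0⇒i≡0 (ℕₚ.n<1⇒n≡0 (subst (∣ z (suc t) ∣ ℕ.<_) ∣e∣≡1
                                   (proj₁ (proj₂ (invariant (suc t) before)))))

    divisible : ∀ j → j ℕ.< suc t → m j ∣ Qform Δ (z j) (+ 1)
    divisible j j<T = ∣⇒∣ᵤ (subst (m j ∣ₛ_) (sym (Q≡ (z j) (+ 1)))
                              (proj₁ (invariant j (λ i i<j → before i (ℕₚ.<-trans i<j j<T)))))

    coprime : gcd x y ≡ + 1
    coprime = trans (gcd-cong-abs {x} {cont (suc t) k} {y} {cont t k} ∣x∣≡ ∣y∣≡) (gcd-cont t k)
      where
      ∣x∣≡ : ∣ x ∣ ≡ ∣ cont (suc t) k ∣
      ∣x∣≡ = trans (cong ∣_∣ x≡) (abs-unit-* (e ^ suc t) (abs-unit-^ e ∣e∣≡1 (suc t)) _)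
      ∣y∣≡ : ∣ y ∣ ≡ ∣ cont t k ∣
      ∣y∣≡ = trans (cong ∣_∣ y≡) (abs-unit-* (e ^ t) (abs-unit-^ e ∣e∣≡1 t) _)

    value : Qform Δ x y ≡ m 0 * e
    value = begin
      Qform Δ x y                      ≡⟨ trans (Q≡ x y) (cong₂ Q x≡ y≡) ⟩
      Q (e * p * u) (p * v)            ≡⟨ cong (λ w → Q w (p * v)) (swap e p u) ⟩
      Q (p * (e * u)) (p * v)          ≡⟨ form-homogeneous (+ 1) B H p (e * u) v ⟩
      p * p * Q (e * u) v              ≡⟨ cong (_* Q (e * u) v) (unit-square p (abs-unit-^ e ∣e∣≡1 t)) ⟩
      1ℤ * Q (e * u) v                 ≡⟨ *-identityˡ (Q (e * u) v) ⟩
      Q (e * u) v                      ≡⟨ cong (λ w → Q w v) (sym z-term-vanishes) ⟩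
      Q (e * u + z (suc t) * v) v      ≡⟨ proj₂ (proj₂ (invariant (suc t) before)) ⟩
      m 0 * e                          ∎
      where
      open ≡-Reasoning
      p u v : ℤ
      p = e ^ t
      u = cont (suc t) k
      v = cont t k
      swap : ∀ e p u → e * p * u ≡ p * (e * u)
      swap = solve-∀
      z-term-vanishes : e * u + z (suc t) * v ≡ e * u
      z-term-vanishes = trans (cong (λ w → e * u + w * v) z≡0) (+-identityʳ (e * u))

  result : ∃[ T ] ((∀ j → j ℕ.< T → ∣ m j ∣ ≢ 1) ×
                   (∣ m T ∣ ≡ 1) ×
                   (∀ j → j ℕ.< T → m j ∣ Qform Δ (z j) (+ 1)) ×
                   (gcd (cont T (λ i → m T * k (suc T ∸ i)))
                        (cont (T ∸ 1) (λ i → m T * k (T ∸ i))) ≡ + 1) ×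
                   (Qform Δ (cont T (λ i → m T * k (suc T ∸ i)))
                            (cont (T ∸ 1) (λ i → m T * k (T ∸ i))) ≡ m 0 * m T))
  result with terminates
  ... | zero , _ , ∣m₀∣≡1 = ⊥-elim (ℕₚ.<-irrefl (sym ∣m₀∣≡1) 1<∣m₀∣)
  ... | suc t , before , ∣m∣≡1 = suc t , before , ∣m∣≡1 , divisible , coprime , value
    where open AtTermination before ∣m∣≡1

proposition4p2 : (Δ : ℤ) → Δ ∈ classNumberOneDiscs →
    (m₀ z₀ : ℤ) → 1 ℕ.< ∣ m₀ ∣ → 1 ℕ.< ∣ z₀ ∣ → ∣ z₀ ∣ ℕ.< ∣ m₀ ∣ →
    m₀ ∣ Qform Δ z₀ (+ 1) →
    (m z k : ℕ → ℤ) → m 0 ≡ m₀ → z 0 ≡ z₀ →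
    (∀ s → Running m s → StepOK Δ m z k s) →
    ∃[ T ] ((∀ j → j ℕ.< T → ∣ m j ∣ ≢ 1) ×
            (∣ m T ∣ ≡ 1) ×
            (∀ j → j ℕ.< T → m j ∣ Qform Δ (z j) (+ 1)) ×
            (gcd (cont T (λ i → m T * k (suc T ∸ i)))
                 (cont (T ∸ 1) (λ i → m T * k (T ∸ i))) ≡ + 1) ×
            (Qform Δ (cont T (λ i → m T * k (suc T ∸ i)))
                     (cont (T ∸ 1) (λ i → m T * k (T ∸ i))) ≡ m₀ * m T))
proposition4p2 Δ Δ∈ _ _ 1<∣m₀∣ _ ∣z₀∣<∣m₀∣ m₀∣Q m z k refl refl step =
  let b , h , b≤1 , Q≡ , small = classNumberOne-principalForm Δ∈ in
  Procedure.result {Δ} {+ b} {+ h} {+ (h ∸ 1)} Q≡ (descent b≤1 small) {m} {z} {k}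
    1<∣m₀∣ ∣z₀∣<∣m₀∣ (subst (m 0 ∣ₛ_) (Q≡ (z 0) (+ 1)) (∣ᵤ⇒∣ m₀∣Q)) step
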